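{- Let $\mathcal{X}$ be an $n$-premaniplex and $(\mathcal{Y},\eta)$ an $(n,m)$-voltage operator. Let $\tau\in\mathrm{Aut}(\mathcal{Y})$ be such that there exists a group homomorphism $\tau^\#:\mathcal{C}^n\to\mathcal{C}^n$ with $\tau^\#(\eta(W))=\eta(W\tau)$ for every $W\in\Pi(\mathcal{Y})$, and suppose $\mathcal{X}^{\tau^\#}$ is isomorphic to $\mathcal{X}$. Then $\tau$ lifts to $\mathcal{X}\rtimes_\eta\mathcal{Y}$.
   Context: A graph may have multiple edges and semi-edges. An $n$-premaniplex is such a graph with edges coloured by $\{0,\dots,n-1\}$ so that every vertex (flag) is the starting point of exactly one dart of each colour, and whenever $|i-j|\ge2$ every alternating path of length 4 with colours $i,j$ is closed; $x^i$ is the end of the $i$-dart at $x$. $\mathcal{C}^n=\langle r_0,\dots,r_{n-1}\mid r_i^2=1,\ (r_ir_j)^2=1\ (|i-j|\ge2)\rangle$ acts on the left on flags by $r_ix=x^i$. Isomorphisms are bijections of flags preserving all $i$-adjacencies; automorphisms act on the right and $\tau\in\mathrm{Aut}(\mathcal{Y})$ maps each path $W$ to a path $W\tau$. For a flag $y$ of an $m$-premaniplex $\mathcal{Y}$ and $\omega\in\mathcal{C}^m$, $P_\omega(y)$ is the homotopy class of paths from $y$ whose successive colours $i_1,\dots,i_k$ satisfy $r_{i_k}\cdots r_{i_1}=\omega$ (homotopic iff same start and same element of $\mathcal{C}^m$); these form the fundamental groupoid $\Pi(\mathcal{Y})$. A voltage assignment $\eta:\Pi(\mathcal{Y})\to\mathcal{C}^n$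 satisfies $\eta(W_1W_2)=\eta(W_2)\eta(W_1)$; $(\mathcal{Y},\eta)$ is an $(n,m)$-voltage operator. $\mathcal{X}\rtimes_\eta\mathcal{Y}$ is the $m$-premaniplex with flags $\mathcal{X}\times\mathcal{Y}$ and $(x,y)^i=(\eta(P_{r_i}(y))x,y^i)$. $\mathcal{X}^{\tau^\#}$ is the $n$-premaniplex with the same flags as $\mathcal{X}$ and $i$-adjacency $x\mapsto\tau^\#(r_i)x$. $\tau$ lifts to $\mathcal{X}\rtimes_\eta\mathcal{Y}$ if there is an automorphism $\tilde\tau$ of $\mathcal{X}\rtimes_\eta\mathcal{Y}$ such that for every flag $(x,y)$ the second coordinate of $(x,y)\tilde\tau$ is $y\tau$. Standing assumption: $\mathcal{Y}$ has a spanning tree (forest if disconnected) all of whose darts have trivial voltage. -}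

module Defs where

open import Data.Nat using (ℕ; _≤_; ∣_-_∣)
open import Data.Fin using (Fin; toℕ)
open import Data.List using (List; []; _∷_; [_]; _++_; reverse; foldl)
open import Data.List.Relation.Unary.All using (All)
open import Data.Product using (Σ; ∃; _×_; _,_; proj₁; proj₂)
open import Data.Empty using (⊥)
open import Data.Unit using (⊤)
open import Relation.Binary.PropositionalEquality using (_≡_)
open import Function.Bundles using (_↔_; Inverse)

-- The group C^n = < r_0..r_{n-1} | r_i^2, (r_i r_j)^2 for |i-j| ≥ 2 >,
-- presented as words modulo the congruence generated by the relations.
-- The word  i₁ ∷ i₂ ∷ … ∷ i_k ∷ []  denotes  r_{i₁} r_{i₂} ⋯ r_{i_k};
-- the product is _++_, the identity is [].

Word : ℕ → Set
Word n = List (Fin n)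

infix 4 _≈_
data _≈_ {n : ℕ} : Word n → Word n → Set where
  ≈-refl  : ∀ {u} → u ≈ u
  ≈-sym   : ∀ {u v} → u ≈ v → v ≈ u
  ≈-trans : ∀ {u v w} → u ≈ v → v ≈ w → u ≈ w
  ≈-cong  : ∀ {u u′ v v′} → u ≈ u′ → v ≈ v′ → u ++ v ≈ u′ ++ v′
  ≈-inv   : ∀ i → (i ∷ i ∷ []) ≈ []
  ≈-comm  : ∀ i j → 2 ≤ ∣ toℕ i - toℕ j ∣ → (i ∷ j ∷ i ∷ j ∷ []) ≈ []

record GroupHom (n m : ℕ) : Set where
  field
    hom      : Word n → Word m
    hom-cong : ∀ {u v} → u ≈ v → hom u ≈ hom v
    hom-mult : ∀ u v → hom (u ++ v) ≈ hom u ++ hom v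
open GroupHom public

-- Edge-coloured graphs in which every vertex (flag) is the start of
-- exactly one dart of each colour: adj i x = x^i.

record ColGraph (n : ℕ) : Set₁ where
  field
    Flag : Set
    adj  : Fin n → Flag → Flag
open ColGraph public

act : ∀ {n} (G : ColGraph n) → Word n → Flag G → Flag G
act G []      x = x
act G (i ∷ w) x = adj G i (act G w x)

record Premaniplex (n : ℕ) : Set₁ where
  field
    graph     : ColGraph n
    adj-invol : ∀ i x → adj graph i (adj graph i x) ≡ x
    adj-comm  : ∀ i j → 2 ≤ ∣ toℕ i - toℕ j ∣ → ∀ x →
                adj graph i (adj graph j (adj graph i (adj graph j x))) ≡ x
open Premaniplex public

PFlag : ∀ {n} → Premaniplex n → Set
PFlag P = Flag (graph P)

record Iso {n} (G H : ColGraph n) : Set where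
  field
    bij  : Flag G ↔ Flag H
    pres : ∀ i x → Inverse.to bij (adj G i x) ≡ adj H i (Inverse.to bij x)
open Iso public

Aut : ∀ {n} → ColGraph n → Set
Aut G = Iso G G

-- apply an automorphism (written on the right in the paper: y ↦ yτ)
app : ∀ {n} {G : ColGraph n} → Aut G → Flag G → Flag G
app τ = Inverse.to (bij τ)

-- Paths in a premaniplex.  A path is given by its start flag y and the
-- list of colours i₁ … i_k of its successive darts.

walk : ∀ {m} (G : ColGraph m) → Flag G → List (Fin m) → Flag G
walk G y cs = foldl (λ z i → adj G i z) y cs

-- the element r_{i_k} ⋯ r_{i₁} of C^m associated with the path
element : ∀ {m} → List (Fin m) → Word m
element cs = reverse cs

-- (n,m)-voltage operator (Y, η): η is defined on Π(Y), i.e. on paths,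
-- constant on homotopy classes (same start, same element of C^m),
-- and η(W₁W₂) = η(W₂) η(W₁).
record VoltageOp (n m : ℕ) : Set₁ where
  field
    Y      : Premaniplex m
    η      : PFlag Y → List (Fin m) → Word n
    η-homotopy : ∀ y cs ds → element cs ≈ element ds → η y cs ≈ η y ds
    η-concat   : ∀ y cs ds →
                 η y (cs ++ ds) ≈ η (walk (graph Y) y cs) ds ++ η y cs
open VoltageOp public

-- Standing assumption: Y has a spanning forest all of whose darts have
-- trivial voltage.  A subgraph is a set T of darts (y , i) closed under
-- reversal; it is acyclic if it contains no nonempty closed walk without
-- backtracking (consecutive equal colours = going back along the same
-- edge); it spans if any two flags joined by a path in Y are joined by
-- a path using only darts of T.
TDarts : ∀ {m} (G : ColGraph m) (T : Flag G → Fin m → Set) →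
         Flag G → List (Fin m) → Set
TDarts G T y []       = ⊤
TDarts G T y (i ∷ cs) = T y i × TDarts G T (adj G i y) cs

data NoBacktrack {m} : List (Fin m) → Set where
  nb-[]  : NoBacktrack []
  nb-[_] : ∀ i → NoBacktrack [ i ]
  nb-∷   : ∀ {i j cs} → (i ≡ j → ⊥) → NoBacktrack (j ∷ cs) →
           NoBacktrack (i ∷ j ∷ cs)

record SpanningForest {m} (G : ColGraph m) (T : Flag G → Fin m → Set) : Set where
  field
    symmetric : ∀ y i → T y i → T (adj G i y) i
    acyclic   : ∀ y i cs → TDarts G T y (i ∷ cs) → NoBacktrack (i ∷ cs) →
                walk G y (i ∷ cs) ≡ y → ⊥
    spanning  : ∀ y y′ → (Σ (List (Fin m)) λ cs → walk G y cs ≡ y′) →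
                Σ (List (Fin m)) λ ds → TDarts G T y ds × walk G y ds ≡ y′

HasTrivialSpanningForest : ∀ {n m} → VoltageOp n m → Set₁
HasTrivialSpanningForest {n} {m} V =
  Σ (PFlag (Y V) → Fin m → Set) λ T →
    SpanningForest (graph (Y V)) T × (∀ y i → T y i → η V y [ i ] ≈ [])

-- X ⋊_η Y : flags X × Y, (x , y)^i = (η(P_{r_i}(y)) x , y^i).
-- P_{r_i}(y) is the class of the one-dart path of colour i from y.
_⋊_ : ∀ {n m} → Premaniplex n → VoltageOp n m → ColGraph m
Flag (X ⋊ V) = PFlag X × PFlag (Y V)
adj  (X ⋊ V) i (x , y) = act (graph X) (η V y [ i ]) x , adj (graph (Y V)) i y

twist : ∀ {n} → Premaniplex n → GroupHom n n → ColGraph n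
Flag (twist X f) = PFlag X
adj  (twist X f) i x = act (graph X) (hom f [ i ]) x

Lifts : ∀ {n m} (X : Premaniplex n) (V : VoltageOp n m) → Aut (graph (Y V)) → Set
Lifts X V τ = Σ (Aut (X ⋊ V)) λ τ̃ →
  ∀ x y → proj₂ (app τ̃ (x , y)) ≡ app τ y

-- The lift is (x , y) ↦ (φ⁻¹ x , y τ) for an isomorphism φ : X^{τ#} ≅ X.
-- Since φ intertwines the action of τ# w with that of w, φ⁻¹ carries the
-- voltage η(P_{r_i}(y)) acting on x to τ# η(P_{r_i}(y)) = η(P_{r_i}(y τ))
-- acting on φ⁻¹ x, which is exactly the i-adjacency of X ⋊_η Y at
-- (φ⁻¹ x , y τ).
module Submission where

open import Defs
open import Data.Nat using (ℕ)
open import Data.List using (List; []; _∷_; [_]; _++_; reverse)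
open import Data.List.Properties using (++-assoc; unfold-reverse)
open import Data.Fin using (Fin)
open import Data.Product using (_,_)
open import Data.Product.Function.NonDependent.Propositional using (_×-↔_)
open import Function.Bundles using (Inverse)
open import Function.Properties.Inverse using (↔-sym)
open import Relation.Binary.Bundles using (Setoid)
open import Relation.Binary.PropositionalEquality hiding ([_])
import Relation.Binary.Reasoning.Setoid as SetoidReasoning

≈-setoid : ℕ → Setoid _ _
≈-setoid n = record
  { Carrier       = Word n
  ; _≈_           = _≈_
  ; isEquivalence = record { refl = ≈-refl ; sym = ≈-sym ; trans = ≈-trans }
  }

module _ {n : ℕ} where
  open SetoidReasoning (≈-setoid n)

  reverse-++-inverseˡ : (w : Word n) → reverse w ++ w ≈ []
  reverse-++-inverseˡ []      = ≈-refl
  reverse-++-inverseˡ (i ∷ w) = begin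
    reverse (i ∷ w) ++ i ∷ w      ≡⟨ cong (_++ i ∷ w) (unfold-reverse i w) ⟩
    (reverse w ++ [ i ]) ++ i ∷ w ≡⟨ ++-assoc (reverse w) [ i ] (i ∷ w) ⟩
    reverse w ++ i ∷ i ∷ w        ≈⟨ ≈-cong ≈-refl (≈-cong (≈-inv i) ≈-refl) ⟩
    reverse w ++ w                ≈⟨ reverse-++-inverseˡ w ⟩
    []                            ∎

module _ {m n : ℕ} (f : GroupHom m n) where
  open SetoidReasoning (≈-setoid n)

  hom-identity : hom f [] ≈ []
  hom-identity = ≈-sym (begin
    []                    ≈⟨ ≈-sym (reverse-++-inverseˡ e) ⟩
    reverse e ++ e        ≈⟨ ≈-cong ≈-refl (hom-mult f [] []) ⟩
    reverse e ++ e ++ e   ≡⟨ ++-assoc (reverse e) e e ⟨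
    (reverse e ++ e) ++ e ≈⟨ ≈-cong (reverse-++-inverseˡ e) ≈-refl ⟩
    e                     ∎)
    where e = hom f []

module _ {n : ℕ} (X : Premaniplex n) where
  private
    actX = act (graph X)

  act-++ : ∀ u v x → actX (u ++ v) x ≡ actX u (actX v x)
  act-++ []      v x = refl
  act-++ (i ∷ u) v x = cong (adj (graph X) i) (act-++ u v x)

  act-resp-≈ : ∀ {u v} → u ≈ v → ∀ x → actX u x ≡ actX v x
  act-resp-≈ ≈-refl          x = refl
  act-resp-≈ (≈-sym p)       x = sym (act-resp-≈ p x)
  act-resp-≈ (≈-trans p q)   x = trans (act-resp-≈ p x) (act-resp-≈ q x)
  act-resp-≈ (≈-cong {u} {u′} {v} {v′} p q) x = begin
    actX (u ++ v) x     ≡⟨ act-++ u v x ⟩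
    actX u (actX v x)   ≡⟨ act-resp-≈ p (actX v x) ⟩
    actX u′ (actX v x)  ≡⟨ cong (actX u′) (act-resp-≈ q x) ⟩
    actX u′ (actX v′ x) ≡⟨ act-++ u′ v′ x ⟨
    actX (u′ ++ v′) x   ∎
    where open ≡-Reasoning
  act-resp-≈ (≈-inv i)       x = adj-invol X i x
  act-resp-≈ (≈-comm i j h)  x = adj-comm X i j h x

  module _ (f : GroupHom n n) (φ : Iso (twist X f) (graph X)) where
    private
      to   = Inverse.to (bij φ)
      from = Inverse.from (bij φ)

    twistIso-to-act : ∀ w z → to (actX (hom f w) z) ≡ actX w (to z)
    twistIso-to-act []      z = cong to (act-resp-≈ (hom-identity f) z)
    twistIso-to-act (i ∷ w) z = begin
      to (actX (hom f (i ∷ w)) z)                ≡⟨ cong to (act-resp-≈ (hom-mult f [ i ] w) z) ⟩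
      to (actX (hom f [ i ] ++ hom f w) z)       ≡⟨ cong to (act-++ (hom f [ i ]) (hom f w) z) ⟩
      to (actX (hom f [ i ]) (actX (hom f w) z)) ≡⟨ pres φ i _ ⟩
      adj (graph X) i (to (actX (hom f w) z))    ≡⟨ cong (adj (graph X) i) (twistIso-to-act w z) ⟩
      actX (i ∷ w) (to z)                        ∎
      where open ≡-Reasoning

    twistIso-from-act : ∀ w x → from (actX w x) ≡ actX (hom f w) (from x)
    twistIso-from-act w x = begin
      from (actX w x)                     ≡⟨ cong (λ x′ → from (actX w x′)) (Inverse.strictlyInverseˡ (bij φ) x) ⟨
      from (actX w (to (from x)))         ≡⟨ cong from (twistIso-to-act w (from x)) ⟨
      from (to (actX (hom f w) (from x))) ≡⟨ Inverse.strictlyInverseʳ (bij φ) _ ⟩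
      actX (hom f w) (from x)             ∎
      where open ≡-Reasoning

module _ {n m : ℕ} (X : Premaniplex n) (V : VoltageOp n m)
         (τ : Aut (graph (Y V))) (τ# : GroupHom n n)
         (φ : Iso (twist X τ#) (graph X)) where

  twistIso-lift : (∀ y i → hom τ# (η V y [ i ]) ≈ η V (app τ y) [ i ]) → Aut (X ⋊ V)
  bij (twistIso-lift _) = ↔-sym (bij φ) ×-↔ bij τ
  pres (twistIso-lift τ#-η) i (x , y) = cong₂ _,_
    (trans (twistIso-from-act X τ# φ (η V y [ i ]) x)
           (act-resp-≈ X (τ#-η y i) (Inverse.from (bij φ) x)))
    (pres τ i y)

  lifts-of-twistIso : (∀ y i → hom τ# (η V y [ i ]) ≈ η V (app τ y) [ i ]) → Lifts X V τ
  lifts-of-twistIso τ#-η = twistIso-lift τ#-η , λ _ _ → refl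

proposition6p4 : ∀ {n m} (X : Premaniplex n) (V : VoltageOp n m) →
    HasTrivialSpanningForest V →
    (τ : Aut (graph (Y V))) →
    (τ# : GroupHom n n) →
    (∀ (y : PFlag (Y V)) (cs : List (Fin m)) → hom τ# (η V y cs) ≈ η V (app τ y) cs) →
    Iso (twist X τ#) (graph X) →
    Lifts X V τ
proposition6p4 X V _ τ τ# τ#-η φ = lifts-of-twistIso X V τ τ# φ (λ y i → τ#-η y [ i ])
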